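{- Let $\alpha$ be a composition, $n\ge1$, and $\beta$ a composition with $\alpha<_c\beta$ such that $\beta/\!\!/\alpha$ is an nc border strip of size $n$, and suppose $j\in NE(\beta/\!\!/\alpha)$. Let $w\in CRHW_n$ with $w(\alpha)=\beta$. Define $w'$ to be the unique reverse hookword with the same content as $w$ such that $\mathrm{leg}(w')=\mathrm{leg}(w)\setminus\{j\}$ if $j\in\mathrm{leg}(w)$, and $\mathrm{leg}(w')=\mathrm{leg}(w)\cup\{j\}$ if $j\notin\mathrm{leg}(w)$. Then $w'(\alpha)=\beta$.
   Context: A composition is a finite sequence $\alpha=(\alpha_1,\ldots,\alpha_k)$ of positive integers; $l(\alpha)=k$, $|\alpha|=\sum\alpha_i$; its diagram is the set of boxes $(i,j)$ with $1\le i\le k$, $1\le j\le\alpha_i$ (rows top to bottom, columns left to right). Write $\alpha\lessdot_c\beta$ if $\beta=(1,\alpha_1,\ldots,\alpha_k)$, or $\beta$ is obtained from $\alpha$ by increasing a part $\alpha_m$ by one where $\alpha_i\ne\alpha_m$ for all $i<m$; $<_c$ is the transitive closure. If $\alpha<_c\beta$ and $d=l(\beta)-l(\alpha)$, $\beta/\!\!/\alpha$ is the set of boxes of the diagram of $\beta$ not of the form $(i'+d,j)$ with $j\le\alpha_{i'}$; its size is $|\beta|-|\alpha|$; it is an interval shape if the set of columns containing its boxes is a set of consecutive integers. An interval shape is an nc border strip if (1) whenever $(i,1),(i,2)\in\beta/\!\!/\alpha$, $(i,1)$ is the bottommost box of column 1 of $\beta/\!\!/\alpha$; (2) whenever $(i,j),(i,j+1)\in\beta/\!\!/\alpha$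 with $j\ge2$, $(i,j)$ is the topmost box of column $j$ of $\beta/\!\!/\alpha$. $NE(\beta/\!\!/\alpha)$ is the set of $j$ such that column $j+1$ contains at least one box of $\beta/\!\!/\alpha$ and for all boxes $(i_1,j+1),(i_2,j)\in\beta/\!\!/\alpha$ one has $i_1<i_2$. Box-adding operators: $\mathfrak{t}_1(\alpha)=(1,\alpha_1,\ldots,\alpha_k)$; for $i\ge2$, $\mathfrak{t}_i(\alpha)$ increases by one the leftmost part equal to $i-1$ if one exists, else is $0$; $\mathfrak{t}_i(0)=0$. A word $w=\mathfrak{t}_{i_1}\cdots\mathfrak{t}_{i_n}$ acts by $w(\alpha)=\mathfrak{t}_{i_1}(\cdots\mathfrak{t}_{i_n}(\alpha)\cdots)$. For $0\le k\le n-1$ it is a reverse $k$-hookword if $i_1\le\cdots\le i_{k+1}>i_{k+2}>\cdots>i_n$; then $\mathrm{leg}(w)=\{i_{k+1},\ldots,i_n\}$ (a set containing the maximum index). Its content is the sequence $(c_1,c_2,\ldots)$ where $c_i$ is the number of $r$ with $i_r=i$. It is connected if $\{i_1,\ldots,i_n\}$ is a set of consecutive integers; $CRHW_n$ is the set of connected reverse hookwords of length $n$. A reverse hookword is determined by its content and its leg: the decreasing tail after position $k+1$ lists $\mathrm{leg}\setminus\{\max\}$ in decreasing order, and the remaining letters form the weakly increasing prefix. -}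

module Defs where

open import Data.Nat using (ℕ; zero; suc; _+_; _∸_; _≤_; _<_; _>_; _≡ᵇ_)
open import Data.List using (List; []; _∷_; length; take; drop; filter)
open import Data.List.Relation.Unary.All using (All)
open import Data.List.Relation.Unary.Linked using (Linked)
open import Data.List.Membership.Propositional using (_∈_)
open import Data.Maybe using (Maybe; just; nothing; _>>=_)
import Data.Maybe as Maybe
open import Data.Bool using (if_then_else_)
open import Data.Product using (_×_; ∃; ∃-syntax)
open import Data.Sum using (_⊎_)
open import Relation.Nullary using (¬_)
open import Relation.Binary.PropositionalEquality using (_≡_; _≢_)
import Data.Nat.Properties as ℕP

IsComposition : List ℕ → Set
IsComposition α = All (λ x → 1 ≤ x) α

-- 1-indexed part α_i; 0 if i = 0 or i > l(α)
part : List ℕ → ℕ → ℕ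
part []       _             = 0
part (x ∷ xs) zero          = 0
part (x ∷ xs) (suc zero)    = x
part (x ∷ xs) (suc (suc i)) = part xs (suc i)

incAt : ℕ → List ℕ → List ℕ
incAt _             []       = []
incAt zero          xs       = xs
incAt (suc zero)    (x ∷ xs) = suc x ∷ xs
incAt (suc (suc m)) (x ∷ xs) = x ∷ incAt (suc m) xs

data _⋖c_ : List ℕ → List ℕ → Set where
  prepend : ∀ {α} → α ⋖c (1 ∷ α)
  bump    : ∀ {α} m → 1 ≤ m → m ≤ length α →
            (∀ i → 1 ≤ i → i < m → part α i ≢ part α m) →
            α ⋖c incAt m α

data _<c_ : List ℕ → List ℕ → Set where
  [_]  : ∀ {α β} → α ⋖c β → α <c β
  _∷ʳ_ : ∀ {α β γ} → α <c β → β ⋖c γ → α <c γ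

-- The skew shape β//α, with d = l(β) - l(α).
-- Box (i , j) lies in β//α iff it is a box of β (1 ≤ i, 1 ≤ j ≤ β_i)
-- and it is not of the form (i' + d , j) with j ≤ α_{i'} (i' ≥ 1).

InSkew : (β α : List ℕ) → ℕ → ℕ → Set
InSkew β α i j =
  1 ≤ i × 1 ≤ j × j ≤ part β i ×
  ¬ (length β ∸ length α < i × j ≤ part α (i ∸ (length β ∸ length α)))

ColNonempty : (β α : List ℕ) → ℕ → Set
ColNonempty β α j = ∃[ i ] InSkew β α i j

IsIntervalShape : (β α : List ℕ) → Set
IsIntervalShape β α =
  ∀ a b c → a ≤ b → b ≤ c → ColNonempty β α a → ColNonempty β α c →
  ColNonempty β α b

IsNCBorderStrip : (β α : List ℕ) → Set
IsNCBorderStrip β α =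
  IsIntervalShape β α ×
  (∀ i → InSkew β α i 1 → InSkew β α i 2 →
         ∀ i' → InSkew β α i' 1 → i' ≤ i) ×
  (∀ i j → 2 ≤ j → InSkew β α i j → InSkew β α i (suc j) →
         ∀ i' → InSkew β α i' j → i ≤ i')

InNE : (β α : List ℕ) → ℕ → Set
InNE β α j =
  ColNonempty β α (suc j) ×
  (∀ i₁ i₂ → InSkew β α i₁ (suc j) → InSkew β α i₂ j → i₁ < i₂)

-- Box-adding operators; `nothing` plays the role of 0.

incFirst : ℕ → List ℕ → Maybe (List ℕ)
incFirst v []       = nothing
incFirst v (x ∷ xs) =
  if x ≡ᵇ v then just (suc x ∷ xs) else Maybe.map (x ∷_) (incFirst v xs)

-- 𝔱_i (only used for i ≥ 1; 𝔱_0 is not defined in the paper, set to 0)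
𝔱 : ℕ → List ℕ → Maybe (List ℕ)
𝔱 zero          α = nothing
𝔱 (suc zero)    α = just (1 ∷ α)
𝔱 (suc (suc k)) α = incFirst (suc k) α

-- word w = 𝔱_{i₁} ⋯ 𝔱_{iₙ} (list [i₁,…,iₙ]) acting on α; 𝔱_i(0) = 0
act : List ℕ → List ℕ → Maybe (List ℕ)
act []      α = just α
act (i ∷ w) α = act w α >>= 𝔱 i

IsRevHook : ℕ → List ℕ → Set
IsRevHook k w = k < length w × Linked _≤_ (take (suc k) w) × Linked _>_ (drop k w)

InLeg : ℕ → List ℕ → ℕ → Set
InLeg k w x = x ∈ drop k w

content : List ℕ → ℕ → ℕ
content w i = length (filter (ℕP._≟ i) w)

IsConnected : List ℕ → Set
IsConnected w = ∀ a b c → a ≤ b → b ≤ c → a ∈ w → c ∈ w → b ∈ w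

IsCRHW : ℕ → ℕ → List ℕ → Set
IsCRHW n k w = length w ≡ n × All (λ x → 1 ≤ x) w × IsRevHook k w × IsConnected w

-- Write w and w' as a weakly increasing prefix followed by the strictly decreasing leg. Sorted
-- words are determined by their content, so toggling j in the leg only moves one letter j across
-- the block Q of letters larger than j that sits between the j's of the prefix and the place of j
-- in the leg: one word is X Q j Y and the other X j Q Y. Now 𝔱_j commutes with 𝔱_y for y > j + 1,
-- and for y = j + 1 the two orders can differ only if the boxes they add include one in column
-- j + 1 weakly below one in column j. Such a pair of boxes of the skew shape survives all later
-- steps, which contradicts j ∈ NE(β//α).

module Submission where

open import Defs hiding ([_])
open import Data.Nat using (ℕ; zero; suc; _+_; _∸_; _≤_; _<_; _>_; _≡ᵇ_; z≤n; s≤s; _≟_)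
open import Data.Nat.Properties
open import Data.Nat.ListAction using (sum)
open import Data.Bool using (true; false; T)
open import Data.List using (List; []; _∷_; [_]; _++_; length; take; drop; filter)
open import Data.List.Properties
  using (++-assoc; filter-++; filter-accept; filter-reject; length-++; take-take; take++drop≡id)
open import Data.List.Relation.Unary.All using (All; []; _∷_)
import Data.List.Relation.Unary.All as All
import Data.List.Relation.Unary.All.Properties as All
open import Data.List.Relation.Unary.AllPairs using (AllPairs; []; _∷_)
import Data.List.Relation.Unary.AllPairs as AllPairs
import Data.List.Relation.Unary.AllPairs.Properties as AllPairs
open import Data.List.Relation.Unary.Linked.Properties using (Linked⇒AllPairs)
open import Data.List.Relation.Unary.Unique.Propositional using (Unique)
open import Data.List.Relation.Unary.Any using (here; there)
open import Data.List.Membership.Propositional using (_∈_; _∉_)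
open import Data.List.Membership.Propositional.Properties using (∈-++⁺ˡ; ∈-++⁺ʳ; ∈-++⁻)
open import Data.List.Membership.DecPropositional _≟_ using (_∈?_)
open import Data.List.Relation.Binary.Permutation.Propositional using (_↭_)
open import Data.List.Relation.Binary.Permutation.Propositional.Properties using (↭-length; filter-↭)
import Data.List.Relation.Binary.Permutation.Propositional.Properties as ↭
open import Data.Maybe using (Maybe; just; nothing; _>>=_)
import Data.Maybe as Maybe
open import Data.Product using (_×_; _,_; ∃-syntax; ∃₂; proj₁; proj₂)
open import Data.Sum using (_⊎_; inj₁; inj₂; [_,_]′)
import Data.Sum as Sum
open import Data.Empty using (⊥-elim)
open import Relation.Nullary using (¬_; yes; no)
open import Relation.Binary.PropositionalEquality
  using (_≡_; _≢_; refl; sym; trans; cong; subst; ≢-sym; module ≡-Reasoning)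
open import Function using (_∘_; id)
open import Relation.Binary.Definitions using (Antisymmetric)
open import Function.Bundles using (_⇔_; mk⇔; Equivalence)
open import Function.Properties.Equivalence using () renaming (sym to ⇔-sym; trans to ⇔-trans)

>>=-just⁻ : ∀ {A B : Set} (m : Maybe A) {f : A → Maybe B} {b : B} →
            (m >>= f) ≡ just b → ∃[ a ] m ≡ just a × f a ≡ just b
>>=-just⁻ (just a) eq = a , refl , eq

map-just⁻ : ∀ {A B : Set} {f : A → B} (m : Maybe A) {b : B} →
            Maybe.map f m ≡ just b → ∃[ a ] m ≡ just a × f a ≡ b
map-just⁻ (just a) refl = a , refl , refl

act-++⁻ : ∀ u v {α γ} → act (u ++ v) α ≡ just γ →
          ∃[ β ] act v α ≡ just β × act u β ≡ just γ
act-++⁻ []      v eq = _ , eq , refl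
act-++⁻ (i ∷ u) v eq with >>=-just⁻ (act (u ++ v) _) eq
... | δ , e , eᵢ with act-++⁻ u v e
...   | β , eᵥ , eᵤ = β , eᵥ , subst (λ m → (m >>= 𝔱 i) ≡ just _) (sym eᵤ) eᵢ

act-++⁺ : ∀ u v {α β γ} → act v α ≡ just β → act u β ≡ just γ → act (u ++ v) α ≡ just γ
act-++⁺ []      v eᵥ refl = eᵥ
act-++⁺ (i ∷ u) v eᵥ eᵤ with >>=-just⁻ (act u _) eᵤ
... | δ , e , eᵢ = subst (λ m → (m >>= 𝔱 i) ≡ just _) (sym (act-++⁺ u v eᵥ e)) eᵢ

incFirst-here : ∀ v τ → incFirst v (v ∷ τ) ≡ just (suc v ∷ τ)
incFirst-here v τ with v ≡ᵇ v in eq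
... | true  = refl
... | false = ⊥-elim (subst T eq (≡⇒≡ᵇ v v refl))

incFirst-there : ∀ {v x} τ → x ≢ v → incFirst v (x ∷ τ) ≡ Maybe.map (x ∷_) (incFirst v τ)
incFirst-there {v} {x} τ x≢v with x ≡ᵇ v in eq
... | true  = ⊥-elim (x≢v (≡ᵇ⇒≡ x v (subst T (sym eq) _)))
... | false = refl

incFirst-just⁻ : ∀ v τ {τ'} → incFirst v τ ≡ just τ' →
                 ∃[ p ] 1 ≤ p × τ' ≡ incAt p τ × part τ p ≡ v × part τ' p ≡ suc v
incFirst-just⁻ v (x ∷ τ) eq with x ≟ v
... | yes refl with trans (sym (incFirst-here x τ)) eq
...   | refl = 1 , s≤s z≤n , refl , refl , refl
incFirst-just⁻ v (x ∷ τ) eq | no x≢v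
  with map-just⁻ (incFirst v τ) (trans (sym (incFirst-there τ x≢v)) eq)
... | τ₀ , e , refl with incFirst-just⁻ v τ e
...   | suc p , _ , refl , q , q' = suc (suc p) , s≤s z≤n , refl , q , q'

length-incAt : ∀ p τ → length (incAt p τ) ≡ length τ
length-incAt zero          []      = refl
length-incAt zero          (_ ∷ _) = refl
length-incAt (suc p)       []      = refl
length-incAt (suc zero)    (_ ∷ _) = refl
length-incAt (suc (suc p)) (x ∷ τ) = cong suc (length-incAt (suc p) τ)

part-incAt : ∀ p τ i → part τ i ≤ part (incAt p τ) i
part-incAt zero          []      i             = ≤-refl
part-incAt zero          (_ ∷ _) i             = ≤-refl
part-incAt (suc p)       []      i             = ≤-refl
part-incAt (suc zero)    (x ∷ τ) zero          = ≤-refl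
part-incAt (suc zero)    (x ∷ τ) (suc zero)    = n≤1+n x
part-incAt (suc zero)    (x ∷ τ) (suc (suc i)) = ≤-refl
part-incAt (suc (suc p)) (x ∷ τ) zero          = ≤-refl
part-incAt (suc (suc p)) (x ∷ τ) (suc zero)    = ≤-refl
part-incAt (suc (suc p)) (x ∷ τ) (suc (suc i)) = part-incAt (suc p) τ (suc i)

incFirst-length : ∀ v τ {τ'} → incFirst v τ ≡ just τ' → length τ' ≡ length τ
incFirst-length v τ eq with incFirst-just⁻ v τ eq
... | p , _ , refl , _ = length-incAt p τ

-- The diagram of α, moved down by l(σ) ∸ l(α) rows, lies inside that of σ.
record Contains (σ α : List ℕ) : Set where
  constructor contains
  field
    length-≤ : length α ≤ length σ
    part-≤   : ∀ i → length σ ∸ length α < i → part α (i ∸ (length σ ∸ length α)) ≤ part σ i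

contains-refl : ∀ α → Contains α α
contains-refl α = contains ≤-refl λ i _ →
  subst (λ d → part α (i ∸ d) ≤ part α i) (sym (n∸n≡0 (length α))) ≤-refl

contains-grow : ∀ {σ σ' α} → length σ' ≡ length σ → (∀ i → part σ i ≤ part σ' i) →
                Contains σ α → Contains σ' α
contains-grow {σ} {σ'} {α} len grow (contains l h) = contains (subst (length α ≤_) (sym len) l) h'
  where
  h' : ∀ i → length σ' ∸ length α < i → part α (i ∸ (length σ' ∸ length α)) ≤ part σ' i
  h' i rewrite len = λ lt → ≤-trans (h i lt) (grow i)

contains-∷ : ∀ x {σ α} → Contains σ α → Contains (x ∷ σ) α
contains-∷ x {σ} {α} (contains l h) = contains (m≤n⇒m≤1+n l) shifted
  where
  below : ∀ i → suc (length σ ∸ length α) < i →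
          part α (i ∸ suc (length σ ∸ length α)) ≤ part (x ∷ σ) i
  below (suc (suc i)) (s≤s lt) = h (suc i) lt
  shifted : ∀ i → suc (length σ) ∸ length α < i →
            part α (i ∸ (suc (length σ) ∸ length α)) ≤ part (x ∷ σ) i
  shifted rewrite +-∸-assoc 1 l = below

contains-𝔱 : ∀ y {σ σ' α} → Contains σ α → 𝔱 y σ ≡ just σ' → Contains σ' α
contains-𝔱 (suc zero)    C refl = contains-∷ 1 C
contains-𝔱 (suc (suc k)) {σ} C eq with incFirst-just⁻ (suc k) σ eq
... | p , _ , refl , _ = contains-grow (length-incAt p σ) (part-incAt p σ) C

contains-act : ∀ P {σ ρ α} → Contains σ α → act P σ ≡ just ρ → Contains ρ α
contains-act []      C refl = C
contains-act (y ∷ P) {σ} C eq with >>=-just⁻ (act P σ) eq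
... | τ , e , e' = contains-𝔱 y (contains-act P C e) e'

inSkew-incAt : ∀ p {τ α i x} → InSkew τ α i x → InSkew (incAt p τ) α i x
inSkew-incAt p {τ} {i = i} (1≤i , 1≤x , x≤ , old) rewrite length-incAt p τ =
  1≤i , 1≤x , ≤-trans x≤ (part-incAt p τ i) , old

inSkew-∷ : ∀ x {τ α i j} → length α ≤ length τ → InSkew τ α i j → InSkew (x ∷ τ) α (suc i) j
inSkew-∷ x {τ} {α} {suc i} {j} l (_ , 1≤j , j≤ , old) = s≤s z≤n , 1≤j , j≤ , old'
  where
  old' : ¬ (suc (length τ) ∸ length α < suc (suc i) ×
            j ≤ part α (suc (suc i) ∸ (suc (length τ) ∸ length α)))
  old' rewrite +-∸-assoc 1 l = λ (lt , le) → old (≤-pred lt , le)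

record NEViolation (ρ α : List ℕ) (j : ℕ) : Set where
  constructor violation
  field
    {i₁ i₂} : ℕ
    rows    : i₂ ≤ i₁
    upper   : InSkew ρ α i₁ (suc j)
    lower   : InSkew ρ α i₂ j

InNE⇒¬NEViolation : ∀ {β α j} → InNE β α j → ¬ NEViolation β α j
InNE⇒¬NEViolation (_ , above) (violation i₂≤i₁ b₁ b₂) = <⇒≱ (above _ _ b₁ b₂) i₂≤i₁

NEViolation-𝔱 : ∀ y {τ τ' α j} → Contains τ α → 𝔱 y τ ≡ just τ' →
                NEViolation τ α j → NEViolation τ' α j
NEViolation-𝔱 (suc zero) {τ} {α = α} C refl (violation le b₁ b₂) =
  violation (s≤s le) (inSkew-∷ 1 {τ} {α} l b₁) (inSkew-∷ 1 {τ} {α} l b₂)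
  where l = Contains.length-≤ C
NEViolation-𝔱 (suc (suc k)) {τ} {α = α} _ eq (violation le b₁ b₂) with incFirst-just⁻ (suc k) τ eq
... | p , _ , refl , _ = violation le (inSkew-incAt p {τ} {α} b₁) (inSkew-incAt p {τ} {α} b₂)

NEViolation-act : ∀ P {σ ρ α j} → Contains σ α → act P σ ≡ just ρ →
                  NEViolation σ α j → NEViolation ρ α j
NEViolation-act []      C refl v = v
NEViolation-act (y ∷ P) {σ} C eq v with >>=-just⁻ (act P σ) eq
... | τ , e , e' = NEViolation-𝔱 y (contains-act P C e) e' (NEViolation-act P C e v)

NewBox : List ℕ → List ℕ → ℕ → ℕ → Set
NewBox τ ρ i x = part τ i < x × x ≤ part ρ i

newBox-inSkew : ∀ {τ ρ α i x} → Contains τ α → length ρ ≡ length τ → 1 ≤ i →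
                NewBox τ ρ i x → InSkew ρ α i x
newBox-inSkew {τ} {ρ} {α} {i} {x} (contains _ h) len 1≤i (new , x≤) =
  1≤i , ≤-trans (s≤s z≤n) new , x≤ , old
  where
  old : ¬ (length ρ ∸ length α < i × x ≤ part α (i ∸ (length ρ ∸ length α)))
  old rewrite len = λ (lt , le) → <⇒≱ new (≤-trans le (h i lt))

record NewViolation (τ ρ : List ℕ) (j : ℕ) : Set where
  constructor newViolation
  field
    {i₁ i₂} : ℕ
    row-pos : 1 ≤ i₂
    rows    : i₂ ≤ i₁
    upper   : NewBox τ ρ i₁ (suc j)
    lower   : NewBox τ ρ i₂ j

newViolation⇒NEViolation : ∀ {τ ρ α j} → Contains τ α → length ρ ≡ length τ →
                           NewViolation τ ρ j → NEViolation ρ α j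
newViolation⇒NEViolation {τ} {ρ} {α} C len (newViolation 1≤i₂ le n₁ n₂) =
  violation le (newBox-inSkew {τ} {ρ} {α} C len (≤-trans 1≤i₂ le) n₁)
               (newBox-inSkew {τ} {ρ} {α} C len 1≤i₂ n₂)

NewViolation-∷ : ∀ x {τ ρ j} → NewViolation τ ρ j → NewViolation (x ∷ τ) (x ∷ ρ) j
NewViolation-∷ x (newViolation {suc i₁} {suc i₂} _ le n₁ n₂) =
  newViolation {i₁ = suc (suc i₁)} {suc (suc i₂)} (s≤s z≤n) (s≤s le) n₁ n₂

Commute : (List ℕ → Maybe (List ℕ)) → (List ℕ → Maybe (List ℕ)) → List ℕ → Set
Commute f g τ = (f τ >>= g) ≡ (g τ >>= f)

EitherOrder : (List ℕ → Maybe (List ℕ)) → (List ℕ → Maybe (List ℕ)) → List ℕ → List ℕ → Set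
EitherOrder f g τ ρ = (f τ >>= g) ≡ just ρ ⊎ (g τ >>= f) ≡ just ρ

map-∷->>=-incFirst-here : ∀ v m → (Maybe.map (v ∷_) m >>= incFirst v) ≡ Maybe.map (suc v ∷_) m
map-∷->>=-incFirst-here v nothing  = refl
map-∷->>=-incFirst-here v (just τ) = incFirst-here v τ

map-∷->>=-incFirst-there : ∀ {x v} m → x ≢ v →
                           (Maybe.map (x ∷_) m >>= incFirst v) ≡ Maybe.map (x ∷_) (m >>= incFirst v)
map-∷->>=-incFirst-there nothing  _   = refl
map-∷->>=-incFirst-there (just τ) x≢v = incFirst-there τ x≢v

incFirst₂-there : ∀ {a b x} τ → x ≢ a → x ≢ b →
                  (incFirst a (x ∷ τ) >>= incFirst b) ≡ Maybe.map (x ∷_) (incFirst a τ >>= incFirst b)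
incFirst₂-there {a} {b} τ x≢a x≢b =
  trans (cong (_>>= incFirst b) (incFirst-there τ x≢a)) (map-∷->>=-incFirst-there (incFirst a τ) x≢b)

incFirst₂-length : ∀ a b τ {ρ} → (incFirst a τ >>= incFirst b) ≡ just ρ → length ρ ≡ length τ
incFirst₂-length a b τ eq with >>=-just⁻ (incFirst a τ) eq
... | σ , e , e' = trans (incFirst-length b σ e') (incFirst-length a τ e)

commute-∷ : ∀ {a b x τ} → x ≢ a → x ≢ b → Commute (incFirst a) (incFirst b) τ →
            Commute (incFirst a) (incFirst b) (x ∷ τ)
commute-∷ {a} {b} {x} {τ} x≢a x≢b c = begin
  (incFirst a (x ∷ τ) >>= incFirst b)         ≡⟨ incFirst₂-there τ x≢a x≢b ⟩
  Maybe.map (x ∷_) (incFirst a τ >>= incFirst b) ≡⟨ cong (Maybe.map (x ∷_)) c ⟩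
  Maybe.map (x ∷_) (incFirst b τ >>= incFirst a) ≡⟨ incFirst₂-there τ x≢b x≢a ⟨
  (incFirst b (x ∷ τ) >>= incFirst a)         ∎
  where open ≡-Reasoning

commute-head : ∀ {a b} τ → a ≢ b → suc a ≢ b → Commute (incFirst a) (incFirst b) (a ∷ τ)
commute-head {a} {b} τ a≢b 1+a≢b = begin
  (incFirst a (a ∷ τ) >>= incFirst b)              ≡⟨ cong (_>>= incFirst b) (incFirst-here a τ) ⟩
  incFirst b (suc a ∷ τ)                           ≡⟨ incFirst-there τ 1+a≢b ⟩
  Maybe.map (suc a ∷_) (incFirst b τ)              ≡⟨ map-∷->>=-incFirst-here a (incFirst b τ) ⟨
  (Maybe.map (a ∷_) (incFirst b τ) >>= incFirst a) ≡⟨ cong (_>>= incFirst a) (incFirst-there τ a≢b) ⟨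
  (incFirst b (a ∷ τ) >>= incFirst a)              ∎
  where open ≡-Reasoning

commute-far : ∀ {a b} → a ≢ b → suc a ≢ b → suc b ≢ a → ∀ τ → Commute (incFirst a) (incFirst b) τ
commute-far a≢b _     _     []      = refl
commute-far {a} {b} a≢b 1+a≢b 1+b≢a (x ∷ τ) with x ≟ a | x ≟ b
... | yes refl | _        = commute-head τ a≢b 1+a≢b
... | no _     | yes refl = sym (commute-head τ (≢-sym a≢b) 1+b≢a)
... | no x≢a   | no x≢b   = commute-∷ x≢a x≢b (commute-far a≢b 1+a≢b 1+b≢a τ)

commute-head-suc : ∀ v τ → Commute (incFirst v) (incFirst (suc v)) (suc v ∷ τ)
commute-head-suc v τ = sym (commute-head {suc v} {v} τ 1+n≢n (>⇒≢ (m<n⇒m<1+n (n<1+n v))))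

incFirst₂-stack : ∀ v τ → (incFirst v (v ∷ τ) >>= incFirst (suc v)) ≡ just (suc (suc v) ∷ τ)
incFirst₂-stack v τ =
  trans (cong (_>>= incFirst (suc v)) (incFirst-here v τ)) (incFirst-here (suc v) τ)

incFirst₂-skip-head : ∀ v τ →
  (incFirst (suc v) (v ∷ τ) >>= incFirst v) ≡ Maybe.map (suc v ∷_) (incFirst (suc v) τ)
incFirst₂-skip-head v τ = trans (cong (_>>= incFirst v) (incFirst-there τ (≢-sym 1+n≢n)))
                                (map-∷->>=-incFirst-here v (incFirst (suc v) τ))

adjacent-commute-or-newViolation : ∀ v τ {ρ} → (incFirst v τ >>= incFirst (suc v)) ≡ just ρ →
                      Commute (incFirst v) (incFirst (suc v)) τ ⊎ NewViolation τ ρ (suc v)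
adjacent-commute-or-newViolation v (x ∷ τ) eq with x ≟ v
... | yes refl with trans (sym (incFirst₂-stack x τ)) eq
...   | refl = inj₂ (newViolation {i₁ = 1} {1} (s≤s z≤n) ≤-refl
                       (m<n⇒m<1+n (n<1+n x) , ≤-refl) (n<1+n x , n≤1+n (suc x)))
adjacent-commute-or-newViolation v (x ∷ τ) eq | no x≢v with x ≟ suc v
... | yes refl = inj₁ (commute-head-suc v τ)
... | no x≢1+v with map-just⁻ (incFirst v τ >>= incFirst (suc v))
                              (trans (sym (incFirst₂-there τ x≢v x≢1+v)) eq)
...   | ρ₀ , e , refl =
  Sum.map (commute-∷ x≢v x≢1+v) (NewViolation-∷ x) (adjacent-commute-or-newViolation v τ e)

adjacent-commute-or-newViolationʳ : ∀ v τ {ρ} → (incFirst (suc v) τ >>= incFirst v) ≡ just ρ →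
                      Commute (incFirst v) (incFirst (suc v)) τ ⊎ NewViolation τ ρ (suc v)
adjacent-commute-or-newViolationʳ v (x ∷ τ) eq with x ≟ v
... | yes refl with map-just⁻ (incFirst (suc x) τ) (trans (sym (incFirst₂-skip-head x τ)) eq)
...   | τ₀ , e , refl with incFirst-just⁻ (suc x) τ e
...     | suc q , _ , refl , p₁ , p₂ =
  inj₂ (newViolation {i₁ = suc (suc q)} {1} (s≤s z≤n) (s≤s z≤n)
          (≤-reflexive (cong suc p₁) , ≤-reflexive (sym p₂)) (n<1+n x , ≤-refl))
adjacent-commute-or-newViolationʳ v (x ∷ τ) eq | no x≢v with x ≟ suc v
... | yes refl = inj₁ (commute-head-suc v τ)
... | no x≢1+v with map-just⁻ (incFirst (suc v) τ >>= incFirst v)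
                              (trans (sym (incFirst₂-there τ x≢1+v x≢v)) eq)
...   | ρ₀ , e , refl =
  Sum.map (commute-∷ x≢v x≢1+v) (NewViolation-∷ x) (adjacent-commute-or-newViolationʳ v τ e)

incFirst-commute-or-newViolation : ∀ {a b τ ρ} → a < b → EitherOrder (incFirst a) (incFirst b) τ ρ →
                                   Commute (incFirst a) (incFirst b) τ ⊎ NewViolation τ ρ (suc a)
incFirst-commute-or-newViolation {a} {b} {τ} a<b h with m≤n⇒m<n∨m≡n a<b
... | inj₁ 1+a<b = inj₁ (commute-far (<⇒≢ a<b) (<⇒≢ 1+a<b) (>⇒≢ (m<n⇒m<1+n a<b)) τ)
... | inj₂ refl  = [ adjacent-commute-or-newViolation a τ , adjacent-commute-or-newViolationʳ a τ ]′ h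

-- 𝔱₁ prepends a part 1, which is incFirst 0 after prepending a part 0; so 𝔱 (suc v) acts as
-- incFirst v on pad v τ.
pad : ℕ → List ℕ → List ℕ
pad zero    τ = 0 ∷ τ
pad (suc _) τ = τ

contains-pad : ∀ v {τ α} → Contains τ α → Contains (pad v τ) α
contains-pad zero    = contains-∷ 0
contains-pad (suc _) C = C

𝔱₂-as-incFirst₂ : ∀ v u τ →
  (𝔱 (suc v) τ >>= 𝔱 (suc (suc u))) ≡ (incFirst v (pad v τ) >>= incFirst (suc u))
𝔱₂-as-incFirst₂ zero    u τ = refl
𝔱₂-as-incFirst₂ (suc v) u τ = refl

𝔱₂-as-incFirst₂ʳ : ∀ v u τ →
  (𝔱 (suc (suc u)) τ >>= 𝔱 (suc v)) ≡ (incFirst (suc u) (pad v τ) >>= incFirst v)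
𝔱₂-as-incFirst₂ʳ zero u τ with incFirst (suc u) τ
... | nothing = refl
... | just _  = refl
𝔱₂-as-incFirst₂ʳ (suc v) u τ = refl

𝔱-commute-or-NEViolation : ∀ {j y τ ρ α} → j < y → Contains τ α → EitherOrder (𝔱 j) (𝔱 y) τ ρ →
                           Commute (𝔱 j) (𝔱 y) τ ⊎ NEViolation ρ α j
𝔱-commute-or-NEViolation {zero} {y} {τ} _ _ _ with 𝔱 y τ
... | nothing = inj₁ refl
... | just _  = inj₁ refl
𝔱-commute-or-NEViolation {suc v} {suc (suc u)} {τ} {ρ} (s≤s v<1+u) C h =
  Sum.map (λ c → trans E (trans c (sym L))) (newViolation⇒NEViolation (contains-pad v C) len)
          (incFirst-commute-or-newViolation v<1+u h')
  where
  E = 𝔱₂-as-incFirst₂ v u τ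
  L = 𝔱₂-as-incFirst₂ʳ v u τ
  h' : EitherOrder (incFirst v) (incFirst (suc u)) (pad v τ) ρ
  h' = Sum.map (trans (sym E)) (trans (sym L)) h
  len : length ρ ≡ length (pad v τ)
  len = [ incFirst₂-length v (suc u) (pad v τ) , incFirst₂-length (suc u) v (pad v τ) ]′ h'

𝔱-commute : ∀ {j y τ ρ α} → j < y → Contains τ α → ¬ NEViolation ρ α j →
            EitherOrder (𝔱 j) (𝔱 y) τ ρ → Commute (𝔱 j) (𝔱 y) τ
𝔱-commute j<y C ¬v h = [ id , (λ v → ⊥-elim (¬v v)) ]′ (𝔱-commute-or-NEViolation j<y C h)

slide-left : ∀ {α j} Q {σ ρ} → All (j <_) Q → Contains σ α → ¬ NEViolation ρ α j →
             act (Q ++ [ j ]) σ ≡ just ρ → act (j ∷ Q) σ ≡ just ρ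
slide-left []      _             _ _  eq = eq
slide-left {α} {j} (y ∷ Q) {σ} (j<y ∷ j<Q) C ¬v eq
  with act-++⁻ [ y ] (Q ++ [ j ]) eq
... | ρ' , eQj , ey with act-++⁻ [ j ] Q (slide-left Q j<Q C ¬v' eQj)
  where ¬v' = ¬v ∘ NEViolation-𝔱 y (contains-act (Q ++ [ j ]) C eQj) ey
...   | τ , eQ , ej = act-++⁺ (j ∷ y ∷ []) Q eQ (trans (sym c) step)
  where
  step = act-++⁺ [ y ] [ j ] ej ey
  c    = 𝔱-commute j<y (contains-act Q C eQ) ¬v (inj₁ step)

slide-right : ∀ {α j} Q {σ ρ} → All (j <_) Q → Contains σ α → ¬ NEViolation ρ α j →
              act (j ∷ Q) σ ≡ just ρ → act (Q ++ [ j ]) σ ≡ just ρ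
slide-right []      _             _ _  eq = eq
slide-right {α} {j} (y ∷ Q) {σ} (j<y ∷ j<Q) C ¬v eq
  with act-++⁻ (j ∷ y ∷ []) Q eq
... | τ , eQ , step with act-++⁻ [ y ] [ j ] (trans c step)
  where c = 𝔱-commute j<y (contains-act Q C eQ) ¬v (inj₂ step)
...   | ρ' , ej , ey = act-++⁺ [ y ] (Q ++ [ j ]) (slide-right Q j<Q C ¬v' eQj) ey
  where
  eQj = act-++⁺ [ j ] Q eQ ej
  ¬v' = ¬v ∘ NEViolation-𝔱 y (contains-act (j ∷ Q) C eQj) ey

act-resp-middle : ∀ {α β j} X {M M'} Y → InNE β α j →
  (∀ {σ ρ} → Contains σ α → ¬ NEViolation ρ α j → act M σ ≡ just ρ → act M' σ ≡ just ρ) →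
  act (X ++ M ++ Y) α ≡ just β → act (X ++ M' ++ Y) α ≡ just β
act-resp-middle {α} X {M} {M'} Y j∈NE replace eq with act-++⁻ X (M ++ Y) eq
... | ρ , eMY , eX with act-++⁻ M Y eMY
...   | σ , eY , eM = act-++⁺ X (M' ++ Y) (act-++⁺ M' Y eY (replace Cσ ¬v eM)) eX
  where
  Cσ = contains-act Y (contains-refl α) eY
  ¬v = InNE⇒¬NEViolation j∈NE ∘ NEViolation-act X (contains-act M Cσ eM) eX

slide⇔ : ∀ {α β j} X Q Y → All (j <_) Q → InNE β α j →
         act (X ++ Q ++ j ∷ Y) α ≡ just β ⇔ act (X ++ j ∷ Q ++ Y) α ≡ just β
slide⇔ {α} {β} {j} X Q Y j<Q j∈NE = mk⇔
  (act-resp-middle X Y j∈NE (slide-left Q j<Q) ∘ subst (λ v → act v α ≡ just β) j-last)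
  (subst (λ v → act v α ≡ just β) (sym j-last) ∘ act-resp-middle X Y j∈NE (slide-right Q j<Q))
  where
  j-last : X ++ Q ++ j ∷ Y ≡ X ++ (Q ++ [ j ]) ++ Y
  j-last = cong (X ++_) (sym (++-assoc Q [ j ] Y))

content-++ : ∀ xs ys z → content (xs ++ ys) z ≡ content xs z + content ys z
content-++ xs ys z = trans (cong length (filter-++ (_≟ z) xs ys)) (length-++ (filter (_≟ z) xs))

content-∷-≡ : ∀ z xs → content (z ∷ xs) z ≡ suc (content xs z)
content-∷-≡ z xs = cong length (filter-accept (_≟ z) {z} {xs} refl)

content-∷-≢ : ∀ {x z} xs → x ≢ z → content (x ∷ xs) z ≡ content xs z
content-∷-≢ {x} xs x≢z = cong length (filter-reject (_≟ _) {x} {xs} x≢z)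

content-∉ : ∀ {z} xs → z ∉ xs → content xs z ≡ 0
content-∉     []       _   = refl
content-∉ {z} (x ∷ xs) z∉ with x ≟ z
... | yes refl = ⊥-elim (z∉ (here refl))
... | no x≢z   = trans (content-∷-≢ xs x≢z) (content-∉ xs (z∉ ∘ there))

content-pos⇒∈ : ∀ {z} xs → 0 < content xs z → z ∈ xs
content-pos⇒∈ {z} xs pos with z ∈? xs
... | yes z∈ = z∈
... | no  z∉ = ⊥-elim (<-irrefl (sym (content-∉ xs z∉)) pos)

content-↭ : ∀ {xs ys} → xs ↭ ys → ∀ z → content xs z ≡ content ys z
content-↭ p z = ↭-length (filter-↭ (_≟ z) p)

unique-content-∈ : ∀ {z xs} → Unique xs → z ∈ xs → content xs z ≡ 1
unique-content-∈ {xs = z ∷ xs} (z≢ ∷ _) (here refl) =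
  trans (content-∷-≡ z xs) (cong suc (content-∉ xs (λ z∈ → All.lookup z≢ z∈ refl)))
unique-content-∈ {xs = x ∷ xs} (x≢ ∷ u) (there z∈) =
  trans (content-∷-≢ xs (All.lookup x≢ z∈)) (unique-content-∈ u z∈)

unique-content-≡ : ∀ {xs ys} → Unique xs → Unique ys → (∀ z → z ∈ xs ⇔ z ∈ ys) →
                   ∀ z → content xs z ≡ content ys z
unique-content-≡ {xs} {ys} uxs uys same z with z ∈? xs
... | yes z∈ = trans (unique-content-∈ uxs z∈) (sym (unique-content-∈ uys (Equivalence.to (same z) z∈)))
... | no  z∉ = trans (content-∉ xs z∉) (sym (content-∉ ys (z∉ ∘ Equivalence.from (same z))))

sorted-content-unique : ∀ {R : ℕ → ℕ → Set} → Antisymmetric _≡_ R → ∀ {xs ys} →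
                        AllPairs R xs → AllPairs R ys → (∀ z → content xs z ≡ content ys z) → xs ≡ ys
sorted-content-unique antisym [] [] _ = refl
sorted-content-unique antisym {ys = y ∷ ys} [] _ same =
  ⊥-elim (0≢1+n (trans (same y) (content-∷-≡ y ys)))
sorted-content-unique antisym {xs = x ∷ xs} _ [] same =
  ⊥-elim (0≢1+n (trans (sym (same x)) (content-∷-≡ x xs)))
sorted-content-unique antisym {x ∷ xs} {y ∷ ys} (Rx ∷ sxs) (Ry ∷ sys) same
  with heads (content-pos⇒∈ (y ∷ ys) (occurs x xs y ys same))
             (content-pos⇒∈ (x ∷ xs) (occurs y ys x xs (sym ∘ same)))
  where
  occurs : ∀ a as b bs → (∀ z → content (a ∷ as) z ≡ content (b ∷ bs) z) → 0 < content (b ∷ bs) a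
  occurs a as b bs same = subst (0 <_) (trans (sym (content-∷-≡ a as)) (same a)) (s≤s z≤n)
  heads : x ∈ y ∷ ys → y ∈ x ∷ xs → x ≡ y
  heads (here x≡y) _          = x≡y
  heads _          (here y≡x) = sym y≡x
  heads (there x∈) (there y∈) = antisym (All.lookup Rx y∈) (All.lookup Ry x∈)
... | refl = cong (x ∷_) (sorted-content-unique antisym sxs sys tails)
  where
  tails : ∀ z → content xs z ≡ content ys z
  tails z = +-cancelˡ-≡ (content [ x ] z) _ _
    (trans (sym (content-++ [ x ] xs z)) (trans (same z) (content-++ [ x ] ys z)))

ascending-split : ∀ j {A} → AllPairs _≤_ A →
                  ∃₂ λ A₁ A₂ → A ≡ A₁ ++ A₂ × All (_≤ j) A₁ × All (j <_) A₂
ascending-split j [] = [] , [] , refl , [] , []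
ascending-split j {x ∷ A} (x≤ ∷ s) with x ≤? j
... | no x≰j = [] , x ∷ A , refl , [] , j<x ∷ All.map (<-≤-trans j<x) x≤
  where j<x = ≰⇒> x≰j
... | yes x≤j with ascending-split j s
...   | A₁ , A₂ , refl , ≤j , j< = x ∷ A₁ , A₂ , refl , x≤j ∷ ≤j , j<

descending-split : ∀ {j L} → AllPairs _>_ L → j ∈ L →
                   ∃₂ λ L₁ L₂ → L ≡ L₁ ++ j ∷ L₂ × All (j <_) L₁ × All (_< j) L₂
descending-split (x> ∷ _) (here refl) = [] , _ , refl , [] , x>
descending-split {L = x ∷ _} (x> ∷ s) (there j∈) with descending-split s j∈
... | L₁ , L₂ , refl , j< , <j = x ∷ L₁ , L₂ , refl , All.lookup x> j∈ ∷ j< , <j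

AllPairs-insert : ∀ {R : ℕ → ℕ → Set} xs {ys v} → AllPairs R (xs ++ ys) →
                  All (λ x → R x v) xs → All (R v) ys → AllPairs R (xs ++ v ∷ ys)
AllPairs-insert []       s        []         Rv = Rv ∷ s
AllPairs-insert (x ∷ xs) (Rx ∷ s) (xRv ∷ Rv) vR =
  All.++⁺ (All.++⁻ˡ xs Rx) (xRv ∷ All.++⁻ʳ xs Rx) ∷ AllPairs-insert xs s Rv vR

AllPairs-remove : ∀ {R : ℕ → ℕ → Set} xs {ys v} → AllPairs R (xs ++ v ∷ ys) → AllPairs R (xs ++ ys)
AllPairs-remove []       (_ ∷ s)  = s
AllPairs-remove (x ∷ xs) (Rx ∷ s) =
  All.++⁺ (All.++⁻ˡ xs Rx) (All.tail (All.++⁻ʳ xs Rx)) ∷ AllPairs-remove xs s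

∈-remove⇔ : ∀ {j} L₁ L₂ → All (j <_) L₁ → All (_< j) L₂ →
            ∀ x → x ∈ L₁ ++ L₂ ⇔ (x ∈ L₁ ++ j ∷ L₂ × x ≢ j)
∈-remove⇔ L₁ L₂ j< <j x = mk⇔ to from
  where
  to : x ∈ L₁ ++ L₂ → x ∈ L₁ ++ _ ∷ L₂ × x ≢ _
  to x∈ with ∈-++⁻ L₁ x∈
  ... | inj₁ x∈₁ = ∈-++⁺ˡ x∈₁ , λ x≡j → <-irrefl (sym x≡j) (All.lookup j< x∈₁)
  ... | inj₂ x∈₂ = ∈-++⁺ʳ L₁ (there x∈₂) , λ x≡j → <-irrefl x≡j (All.lookup <j x∈₂)
  from : x ∈ L₁ ++ _ ∷ L₂ × x ≢ _ → x ∈ L₁ ++ L₂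
  from (x∈ , x≢j) with ∈-++⁻ L₁ x∈
  ... | inj₁ x∈₁         = ∈-++⁺ˡ x∈₁
  ... | inj₂ (here x≡j)  = ⊥-elim (x≢j x≡j)
  ... | inj₂ (there x∈₂) = ∈-++⁺ʳ L₁ x∈₂

regroup : ∀ (a b c d : List ℕ) → (a ++ b) ++ (c ++ d) ≡ a ++ (b ++ c) ++ d
regroup a b c d = trans (++-assoc a b (c ++ d)) (cong (a ++_) (sym (++-assoc b c d)))

leg-toggle : ∀ {j A L A' L'} →
  AllPairs _≤_ A → AllPairs _>_ L → AllPairs _≤_ A' → AllPairs _>_ L' →
  (∀ z → content (A' ++ L') z ≡ content (A ++ L) z) →
  j ∈ L → (∀ x → x ∈ L' ⇔ (x ∈ L × x ≢ j)) →
  ∃[ X ] ∃[ Q ] ∃[ Y ] All (j <_) Q × A ++ L ≡ X ++ Q ++ j ∷ Y × A' ++ L' ≡ X ++ j ∷ Q ++ Y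
leg-toggle {j} {A' = A'} {L'} sA sL sA' sL' same j∈L leg
  with ascending-split j sA | descending-split sL j∈L
... | A₁ , A₂ , refl , ≤j , j<A₂ | L₁ , L₂ , refl , j<L₁ , <j
  with L'≡ | A'≡
  where
  sL₁₂ = AllPairs-remove L₁ sL
  L'≡ : L' ≡ L₁ ++ L₂
  L'≡ = sorted-content-unique (λ x<y y<x → ⊥-elim (<-asym x<y y<x)) sL' sL₁₂
          (unique-content-≡ (AllPairs.map >⇒≢ sL') (AllPairs.map >⇒≢ sL₁₂)
            (λ x → ⇔-trans (leg x) (⇔-sym (∈-remove⇔ L₁ L₂ j<L₁ <j x))))
  moved : ∀ z → content (A' ++ L') z ≡ content ((A₁ ++ j ∷ A₂) ++ L') z
  moved z = begin
    content (A' ++ L') z                           ≡⟨ same z ⟩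
    content ((A₁ ++ A₂) ++ (L₁ ++ j ∷ L₂)) z       ≡⟨ cong (λ v → content v z) (regroup A₁ A₂ L₁ (j ∷ L₂)) ⟩
    content (A₁ ++ (A₂ ++ L₁) ++ j ∷ L₂) z         ≡⟨ content-↭ (↭.++⁺ˡ A₁ (↭.shift j (A₂ ++ L₁) L₂)) z ⟩
    content (A₁ ++ j ∷ (A₂ ++ L₁) ++ L₂) z         ≡⟨ cong (λ v → content v z) (regroup A₁ (j ∷ A₂) L₁ L₂) ⟨
    content ((A₁ ++ j ∷ A₂) ++ (L₁ ++ L₂)) z       ≡⟨ cong (λ v → content ((A₁ ++ j ∷ A₂) ++ v) z) L'≡ ⟨
    content ((A₁ ++ j ∷ A₂) ++ L') z               ∎
    where open ≡-Reasoning
  A'≡ : A' ≡ A₁ ++ j ∷ A₂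
  A'≡ = sorted-content-unique ≤-antisym sA' (AllPairs-insert A₁ sA ≤j (All.map <⇒≤ j<A₂)) λ z →
          +-cancelʳ-≡ (content L' z) _ _
            (trans (sym (content-++ A' L' z)) (trans (moved z) (content-++ (A₁ ++ j ∷ A₂) L' z)))
... | refl | refl =
  A₁ , A₂ ++ L₁ , L₂ , All.++⁺ j<A₂ j<L₁ , regroup A₁ A₂ L₁ (j ∷ L₂) , regroup A₁ (j ∷ A₂) L₁ L₂

hook-sorted : ∀ {k w} → IsRevHook k w → AllPairs _≤_ (take k w) × AllPairs _>_ (drop k w)
hook-sorted {k} {w} (_ , ascending , descending) =
  subst (AllPairs _≤_) take-k (AllPairs.take⁺ k (Linked⇒AllPairs ≤-trans ascending)) ,
  Linked⇒AllPairs (λ j<i k<j → <-trans k<j j<i) descending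
  where
  take-k : take k (take (suc k) w) ≡ take k w
  take-k = trans (take-take k (suc k) w) (cong (λ m → take m w) (m≤n⇒m⊓n≡m (n≤1+n k)))

hookword-toggle : ∀ {j k w k' w'} → IsRevHook k w → IsRevHook k' w' →
  (∀ z → content w' z ≡ content w z) →
  j ∈ drop k w → (∀ x → x ∈ drop k' w' ⇔ (x ∈ drop k w × x ≢ j)) →
  ∃[ X ] ∃[ Q ] ∃[ Y ] All (j <_) Q × w ≡ X ++ Q ++ j ∷ Y × w' ≡ X ++ j ∷ Q ++ Y
hookword-toggle {k = k} {w} {k'} {w'} hook hook' same j∈ leg
  with leg-toggle (proj₁ (hook-sorted hook)) (proj₂ (hook-sorted hook))
                  (proj₁ (hook-sorted hook')) (proj₂ (hook-sorted hook')) same' j∈ leg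
  where
  same' : ∀ z → content (take k' w' ++ drop k' w') z ≡ content (take k w ++ drop k w) z
  same' z rewrite take++drop≡id k w | take++drop≡id k' w' = same z
... | X , Q , Y , j<Q , w≡ , w'≡ =
  X , Q , Y , j<Q , trans (sym (take++drop≡id k w)) w≡ , trans (sym (take++drop≡id k' w')) w'≡

module _ {P P' : ℕ → Set} {j : ℕ}
         (toggle : ∀ x → P' x ⇔ ((P x × x ≢ j) ⊎ (x ≡ j × ¬ P x))) where

  toggle-remove : P j → ∀ x → P' x ⇔ (P x × x ≢ j)
  toggle-remove Pj x = mk⇔ to (Equivalence.from (toggle x) ∘ inj₁)
    where
    to : P' x → P x × x ≢ j
    to P'x with Equivalence.to (toggle x) P'x
    ... | inj₁ r          = r
    ... | inj₂ (refl , ¬Pj) = ⊥-elim (¬Pj Pj)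

  toggle-add : ¬ P j → P' j × (∀ x → P x ⇔ (P' x × x ≢ j))
  toggle-add ¬Pj = Equivalence.from (toggle j) (inj₂ (refl , ¬Pj)) , λ x → mk⇔ (to x) (from x)
    where
    to : ∀ x → P x → P' x × x ≢ j
    to x Px = Equivalence.from (toggle x) (inj₁ (Px , x≢j)) , x≢j
      where x≢j = λ { refl → ¬Pj Px }
    from : ∀ x → P' x × x ≢ j → P x
    from x (P'x , x≢j) with Equivalence.to (toggle x) P'x
    ... | inj₁ (Px , _)  = Px
    ... | inj₂ (x≡j , _) = ⊥-elim (x≢j x≡j)

lemma5p14 : (α β : List ℕ) (n j : ℕ) →
    IsComposition α → IsComposition β → 1 ≤ n →
    α <c β → IsNCBorderStrip β α → sum β ≡ n + sum α →
    InNE β α j →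
    (w : List ℕ) (k : ℕ) → IsCRHW n k w → act w α ≡ just β →
    (w' : List ℕ) (k' : ℕ) → IsRevHook k' w' →
    (∀ i → content w' i ≡ content w i) →
    (∀ x → InLeg k' w' x ⇔ ((InLeg k w x × x ≢ j) ⊎ (x ≡ j × ¬ InLeg k w x))) →
    act w' α ≡ just β
lemma5p14 α β n j _ _ _ _ _ _ j∈NE w k (_ , _ , hook , _) w↦β w' k' hook' same toggle
  with j ∈? drop k w
... | yes j∈leg with hookword-toggle hook hook' same j∈leg (toggle-remove toggle j∈leg)
...   | X , Q , Y , j<Q , refl , refl = Equivalence.to (slide⇔ X Q Y j<Q j∈NE) w↦β
lemma5p14 α β n j _ _ _ _ _ _ j∈NE w k (_ , _ , hook , _) w↦β w' k' hook' same toggle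
    | no j∉leg with toggle-add toggle j∉leg
... | j∈leg' , toggle' with hookword-toggle hook' hook (sym ∘ same) j∈leg' toggle'
...   | X , Q , Y , j<Q , refl , refl = Equivalence.from (slide⇔ X Q Y j<Q j∈NE) w↦β
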